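{- Let $b\ge 3$ and $d\ge 2$ be integers and let $G_{(d,b)}$ be the graph defined below. Then $\Gamma(G_{(d,b)}) = d+b-2$.
   Context: A set $S\subseteq V(G)$ is a dominating set of a graph $G$ if every vertex of $V(G)\setminus S$ is adjacent to a vertex of $S$; $\Gamma(G)$ denotes the maximum cardinality of a minimal (with respect to inclusion) dominating set of $G$. The graph $G_{(d,b)}$ has vertex set $\{o_j : 1\le j\le b\}\cup\{v_{(i,j)} : 1\le i\le d,\ 1\le j\le b\}$ and the following edges: the vertices $o_1,\dots,o_b$ form a clique $C_0$ (the outer clique); for each $1\le i\le d$, the vertices $v_{(i,1)},\dots,v_{(i,b)}$ form a clique $C_i$ (an inner clique); and for each $1\le i\le d$ and $1\le j\le b$ there is an edge $\{o_j, v_{(i,j)}\}$. There are no other edges. -}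

module Defs where

open import Data.Nat using (ℕ; zero; suc; _*_; _≤_)
open import Data.Fin using (Fin; zero; suc; remQuot)
open import Data.Fin.Subset using (Subset; _∈_; _∉_; _⊆_; ∣_∣)
open import Data.Product using (Σ; _×_; _,_; proj₁; proj₂; ∃-syntax)
open import Data.Sum using (_⊎_)
open import Relation.Binary.PropositionalEquality using (_≡_; _≢_)

record Graph (n : ℕ) : Set₁ where
  field
    Adj : Fin n → Fin n → Set

open Graph public

IsDominating : ∀ {n} → Graph n → Subset n → Set
IsDominating G S = ∀ v → v ∉ S → ∃[ u ] (u ∈ S × Adj G u v)

IsMinimalDominating : ∀ {n} → Graph n → Subset n → Set
IsMinimalDominating G S =
  IsDominating G S × (∀ T → T ⊆ S → IsDominating G T → S ⊆ T)

UpperDominationNumber : ∀ {n} → Graph n → ℕ → Set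
UpperDominationNumber G k =
  (∃[ S ] (IsMinimalDominating G S × ∣ S ∣ ≡ k))
  × (∀ S → IsMinimalDominating G S → ∣ S ∣ ≤ k)

-- Vertices are Fin (suc d * b); a vertex x corresponds
-- to the pair remQuot b x = (i , j) with i : Fin (suc d), j : Fin b.
-- i = zero encodes the outer vertex o_(j+1); i = suc i' encodes v_(i'+1, j+1).
AdjDB : (d b : ℕ) → Fin (suc d * b) → Fin (suc d * b) → Set
AdjDB d b x y =
  x ≢ y ×
  ( (i₁ ≡ i₂)
  ⊎ (j₁ ≡ j₂ × (i₁ ≡ zero ⊎ i₂ ≡ zero)))
  where
    i₁ = proj₁ (remQuot {suc d} b x)
    j₁ = proj₂ (remQuot {suc d} b x)
    i₂ = proj₁ (remQuot {suc d} b y)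
    j₂ = proj₂ (remQuot {suc d} b y)

G[_,_] : (d b : ℕ) → Graph (suc d * b)
G[ d , b ] = record { Adj = AdjDB d b }

-- Every vertex s of a minimal dominating set S has a private neighbour: a vertex of its
-- closed neighbourhood dominated by no other vertex of S.  Call s crowded if it lies in an
-- inner clique together with another vertex of S.  The private neighbour of a crowded s
-- must then be the outer vertex of its column, so S has no outer vertex and no other vertex
-- in that column.  Hence charging outer and crowded vertices of S to their column, and every
-- other vertex of S to its inner clique, is injective into the d + b columns and inner
-- cliques, and a case analysis on the outer and crowded vertices of S exhibits two charges
-- that are never used: |S| ≤ d + b − 2.  Conversely, in the paper's numbering,
-- {v_(1,j) : j ≥ 2} ∪ {v_(i,1) : i ≥ 2} is a minimal dominating set of that size, with
-- private neighbours o_j of v_(1,j) and v_(i,2) of v_(i,1).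

module Submission where

open import Defs
open import Data.Bool using (Bool; true; false)
open import Data.Empty using (⊥-elim)
open import Data.Fin using (Fin; zero; suc; remQuot; combine; join; splitAt; punchIn)
open import Data.Fin.Properties
  using (_≟_; 0≢1+n; any?; all?; ¬∀⟶∃¬; suc-injective; remQuot-combine; combine-remQuot;
         splitAt-join; join-splitAt; punchInᵢ≢i; punchIn-injective)
open import Data.Fin.Subset using (Subset; _∈_; _∉_; _⊆_; ∣_∣; ⊤; ⁅_⁆; _-_)
open import Data.Fin.Subset.Properties
  using (_∈?_; ∈⊤; ∣p∣≤n; ∣⊤∣≡n; p⊆q⇒∣p∣≤∣q∣; p─q⊆p; x∈p∧x≢y⇒x∈p-y; x∈p⇒∣p-x∣<∣p∣)
open import Data.Nat using (ℕ; zero; suc; _+_; _*_; _∸_; _≤_; z≤n; s≤s)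
open import Data.Nat.Properties
  using (≤-trans; ≤-antisym; n≤1+n; +-suc; <⇒≱; ∸-monoˡ-≤; module ≤-Reasoning)
open import Data.Product using (∃-syntax; ∃₂; _×_; _,_; proj₁; proj₂; uncurry)
open import Data.Sum using (_⊎_; inj₁; inj₂)
open import Data.Sum.Properties using (inj₁-injective; inj₂-injective; ≡-dec)
open import Data.Vec using ([]; _∷_; here; there; tabulate; lookup)
open import Data.Vec.Properties using (lookup∘tabulate; []=⇒lookup; lookup⇒[]=)
open import Function using (_∘_)
open import Relation.Nullary using (Dec; yes; no; ¬_)
open import Relation.Nullary.Decidable using (_×-dec_; _⊎-dec_; _→-dec_; ¬?; decidable-stable)
open import Relation.Binary.PropositionalEquality

InjectiveOn : ∀ {m n} → Subset m → (Fin m → Fin n) → Set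
InjectiveOn p f = ∀ {x y} → x ∈ p → y ∈ p → f x ≡ f y → x ≡ y

injectiveOn⇒∣p∣≤∣q∣ : ∀ {m n} {p : Subset m} (q : Subset n) {f : Fin m → Fin n} →
  InjectiveOn p f → (∀ {x} → x ∈ p → f x ∈ q) → ∣ p ∣ ≤ ∣ q ∣
injectiveOn⇒∣p∣≤∣q∣ {p = []} q inj into = z≤n
injectiveOn⇒∣p∣≤∣q∣ {p = false ∷ p} q inj into =
  injectiveOn⇒∣p∣≤∣q∣ {p = p} q (λ x y e → suc-injective (inj (there x) (there y) e))
    (into ∘ there)
injectiveOn⇒∣p∣≤∣q∣ {p = true ∷ p} q {f} inj into =
  ≤-trans (s≤s (injectiveOn⇒∣p∣≤∣q∣ {p = p} (q - f zero) inj′ into′))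
          (x∈p⇒∣p-x∣<∣p∣ (into here))
  where
  inj′ : InjectiveOn p (f ∘ suc)
  inj′ x y e = suc-injective (inj (there x) (there y) e)
  into′ : ∀ {x} → x ∈ p → f (suc x) ∈ q - f zero
  into′ x = x∈p∧x≢y⇒x∈p-y (into (there x)) (λ e → 0≢1+n (inj here (there x) (sym e)))

injectiveOn-avoiding-two⇒∣p∣≤n∸2 : ∀ {m n} {p : Subset m} {f : Fin m → Fin n} {y z} →
  InjectiveOn p f → y ≢ z → (∀ {x} → x ∈ p → f x ≢ y) → (∀ {x} → x ∈ p → f x ≢ z) →
  ∣ p ∣ ≤ n ∸ 2
injectiveOn-avoiding-two⇒∣p∣≤n∸2 {n = n} {p} {y = y} {z} inj y≢z ≢y ≢z = ∸-monoˡ-≤ 2 (begin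
  suc (suc ∣ p ∣)         ≤⟨ s≤s (s≤s (injectiveOn⇒∣p∣≤∣q∣ (⊤ - y - z) inj into)) ⟩
  suc (suc ∣ ⊤ - y - z ∣) ≤⟨ s≤s (x∈p⇒∣p-x∣<∣p∣ (x∈p∧x≢y⇒x∈p-y (∈⊤ {x = z}) (y≢z ∘ sym))) ⟩
  suc ∣ ⊤ - y ∣           ≤⟨ x∈p⇒∣p-x∣<∣p∣ (∈⊤ {x = y}) ⟩
  ∣ ⊤ {n} ∣               ≤⟨ ∣p∣≤n ⊤ ⟩
  n                       ∎)
  where
  open ≤-Reasoning
  into : ∀ {x} → x ∈ p → _ ∈ ⊤ - y - z
  into x = x∈p∧x≢y⇒x∈p-y (x∈p∧x≢y⇒x∈p-y ∈⊤ (≢y x)) (≢z x)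

zero-or-suc : ∀ {n} (i : Fin (suc n)) → i ≡ zero ⊎ ∃[ j ] i ≡ suc j
zero-or-suc zero    = inj₁ refl
zero-or-suc (suc j) = inj₂ (j , refl)

another : ∀ {n} → 2 ≤ n → (i : Fin n) → ∃[ j ] j ≢ i
another (s≤s (s≤s _)) i = punchIn i zero , punchInᵢ≢i i zero

two-others : ∀ {n} → 3 ≤ n → (i : Fin n) → ∃₂ λ j k → j ≢ i × k ≢ i × j ≢ k
two-others (s≤s (s≤s (s≤s _))) i =
  punchIn i zero , punchIn i (suc zero) , punchInᵢ≢i i zero , punchInᵢ≢i i (suc zero) ,
  0≢1+n ∘ punchIn-injective i zero (suc zero)

distinct-pair : ∀ {n} → 2 ≤ n → ∃₂ λ (i j : Fin n) → i ≢ j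
distinct-pair (s≤s (s≤s _)) = zero , suc zero , λ ()

join-injective : ∀ m n {x y : Fin m ⊎ Fin n} → join m n x ≡ join m n y → x ≡ y
join-injective m n {x} {y} e =
  trans (sym (splitAt-join m n x)) (trans (cong (splitAt m) e) (splitAt-join m n y))

splitAt-injective : ∀ m n {x y : Fin (m + n)} → splitAt m x ≡ splitAt m y → x ≡ y
splitAt-injective m n {x} {y} e =
  trans (sym (join-splitAt m n x)) (trans (cong (join m n) e) (join-splitAt m n y))

module _ {n : ℕ} (G : Graph n) where

  Dominates : Fin n → Fin n → Set
  Dominates u v = u ≡ v ⊎ Adj G u v

  IsPrivateNeighbour : Subset n → Fin n → Fin n → Set
  IsPrivateNeighbour S s w = Dominates s w × (∀ u → u ∈ S → Dominates u w → u ≡ s)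

  dominates⇒adjacent : ∀ {T u v} → u ∈ T → v ∉ T → Dominates u v → Adj G u v
  dominates⇒adjacent u∈T v∉T (inj₁ refl) = ⊥-elim (v∉T u∈T)
  dominates⇒adjacent u∈T v∉T (inj₂ u~v)  = u~v

  dominator : ∀ {S} → IsDominating G S → ∀ v → ∃[ u ] u ∈ S × Dominates u v
  dominator {S} dom v with v ∈? S
  ... | yes v∈S = v , v∈S , inj₁ refl
  ... | no  v∉S = let (u , u∈S , u~v) = dom v v∉S in u , u∈S , inj₂ u~v

  private-neighbours⇒minimal : ∀ {S} → IsDominating G S →
    (∀ {s} → s ∈ S → ∃[ w ] IsPrivateNeighbour S s w) → IsMinimalDominating G S
  private-neighbours⇒minimal {S} dom has-private = dom , minimal
    where
    minimal : ∀ T → T ⊆ S → IsDominating G T → S ⊆ T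
    minimal T T⊆S domT {s} s∈S with has-private s∈S
    ... | w , _ , only-s with w ∈? T
    ...   | yes w∈T = subst (_∈ T) (only-s w (T⊆S w∈T) (inj₁ refl)) w∈T
    ...   | no  w∉T with domT w w∉T
    ...     | u , u∈T , u~w = subst (_∈ T) (only-s u (T⊆S u∈T) (inj₂ u~w)) u∈T

  module _ (adjacent? : ∀ u v → Dec (Adj G u v)) {S : Subset n} where

    dominates? : ∀ u v → Dec (Dominates u v)
    dominates? u v = (u ≟ v) ⊎-dec adjacent? u v

    private-neighbour? : ∀ s w → Dec (IsPrivateNeighbour S s w)
    private-neighbour? s w =
      dominates? s w ×-dec all? (λ u → u ∈? S →-dec (dominates? u w →-dec u ≟ s))

    second-dominator : ∀ {s w} → Dominates s w → ¬ IsPrivateNeighbour S s w →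
      ∃[ u ] u ∈ S × u ≢ s × Dominates u w
    second-dominator {s} {w} s~w ¬private =
      let (u , ¬only-s) = ¬∀⟶∃¬ n _ (λ u → u ∈? S →-dec (dominates? u w →-dec u ≟ s))
                                   (λ only-s → ¬private (s~w , only-s))
      in  u , decidable-stable (u ∈? S) (λ u∉S → ¬only-s (⊥-elim ∘ u∉S)) ,
          (λ u≡s → ¬only-s (λ _ _ → u≡s)) ,
          decidable-stable (dominates? u w) (λ ¬u~w → ¬only-s (λ _ → ⊥-elim ∘ ¬u~w))

    dominator-other-than : IsDominating G S → ∀ {s} → (∀ w → ¬ IsPrivateNeighbour S s w) →
      ∀ v → ∃[ u ] u ∈ S × u ≢ s × Dominates u v
    dominator-other-than dom {s} none v with dominator dom v
    ... | u , u∈S , u~v with u ≟ s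
    ...   | no  u≢s  = u , u∈S , u≢s , u~v
    ...   | yes refl = second-dominator u~v (none v)

    without-private-neighbour⇒dominating : IsDominating G S → ∀ {s} →
      (∀ w → ¬ IsPrivateNeighbour S s w) → IsDominating G (S - s)
    without-private-neighbour⇒dominating dom none v v∉S-s =
      let (u , u∈S , u≢s , u~v) = dominator-other-than dom none v
          u∈S-s = x∈p∧x≢y⇒x∈p-y u∈S u≢s
      in  u , u∈S-s , dominates⇒adjacent u∈S-s v∉S-s u~v

    minimal⇒private-neighbour : IsMinimalDominating G S →
      ∀ {s} → s ∈ S → ∃[ w ] IsPrivateNeighbour S s w
    minimal⇒private-neighbour (dom , minimal) {s} s∈S with any? (private-neighbour? s)
    ... | yes found = found
    ... | no  none  = ⊥-elim (<⇒≱ (x∈p⇒∣p-x∣<∣p∣ s∈S) (p⊆q⇒∣p∣≤∣q∣ S⊆S-s))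
      where
      S⊆S-s : S ⊆ S - s
      S⊆S-s = minimal (S - s) (p─q⊆p S ⁅ s ⁆)
                (without-private-neighbour⇒dominating dom (λ w p → none (w , p)))

module Coordinates (d b : ℕ) where

  Vertex : Set
  Vertex = Fin (suc d * b)

  Position : Set
  Position = Fin (suc d) × Fin b

  position : Vertex → Position
  position = remQuot b

  row : Vertex → Fin (suc d)
  row = proj₁ ∘ position

  col : Vertex → Fin b
  col = proj₂ ∘ position

  vtx : Fin (suc d) → Fin b → Vertex
  vtx = combine

  outer : Fin b → Vertex
  outer = vtx zero

  position-vtx : ∀ i j → position (vtx i j) ≡ (i , j)
  position-vtx = remQuot-combine

  position-injective : ∀ {x y} → position x ≡ position y → x ≡ y
  position-injective {x} {y} e =
    trans (sym (combine-remQuot b x)) (trans (cong (uncurry combine) e) (combine-remQuot b y))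

  row-col-injective : ∀ {x y} → row x ≡ row y → col x ≡ col y → x ≡ y
  row-col-injective r c = position-injective (cong₂ _,_ r c)

  vtx-injective : ∀ p q → uncurry vtx p ≡ uncurry vtx q → p ≡ q
  vtx-injective (i , j) (i′ , j′) e =
    trans (sym (position-vtx i j)) (trans (cong position e) (position-vtx i′ j′))

  row-outer : ∀ j → row (outer j) ≡ zero
  row-outer j = cong proj₁ (position-vtx zero j)

  col-outer : ∀ j → col (outer j) ≡ j
  col-outer j = cong proj₂ (position-vtx zero j)

  data Coords : Vertex → Set where
    at : ∀ i j → Coords (vtx i j)

  coords : ∀ x → Coords x
  coords x = subst Coords (combine-remQuot b x) (at (row x) (col x))

  _∼_ : Position → Position → Set
  (i , j) ∼ (i′ , j′) = i ≡ i′ ⊎ (j ≡ j′ × (i ≡ zero ⊎ i′ ≡ zero))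

  _∼?_ : ∀ p q → Dec (p ∼ q)
  (i , j) ∼? (i′ , j′) = (i ≟ i′) ⊎-dec ((j ≟ j′) ×-dec ((i ≟ zero) ⊎-dec (i′ ≟ zero)))

  Near : Vertex → Vertex → Set
  Near x y = position x ∼ position y

  near-vtx : ∀ p q → p ∼ q → Near (uncurry vtx p) (uncurry vtx q)
  near-vtx (i , j) (i′ , j′) = subst₂ _∼_ (sym (position-vtx i j)) (sym (position-vtx i′ j′))

  vtx-near : ∀ p q → Near (uncurry vtx p) (uncurry vtx q) → p ∼ q
  vtx-near (i , j) (i′ , j′) = subst₂ _∼_ (position-vtx i j) (position-vtx i′ j′)

  G : Graph (suc d * b)
  G = G[ d , b ]

  adjacent? : ∀ x y → Dec (Adj G x y)
  adjacent? x y = ¬? (x ≟ y) ×-dec (position x ∼? position y)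

  dominates⇒near : ∀ {x y} → Dominates G x y → Near x y
  dominates⇒near (inj₁ refl)     = inj₁ refl
  dominates⇒near (inj₂ (_ , x∼y)) = x∼y

  near⇒dominates : ∀ {x y} → Near x y → Dominates G x y
  near⇒dominates {x} {y} x∼y with x ≟ y
  ... | yes x≡y = inj₁ x≡y
  ... | no  x≢y = inj₂ (x≢y , x∼y)

  private-neighbour⇒near : ∀ {S s w} → IsPrivateNeighbour G S s w →
    Near s w × (∀ {u} → u ∈ S → Near u w → u ≡ s)
  private-neighbour⇒near (s~w , only-s) =
    dominates⇒near s~w , λ u∈S u∼w → only-s _ u∈S (near⇒dominates u∼w)

  near⇒private-neighbour : ∀ {S s w} → Near s w →
    (∀ {u} → u ∈ S → Near u w → u ≡ s) → IsPrivateNeighbour G S s w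
  near⇒private-neighbour s∼w only-s =
    near⇒dominates s∼w , λ _ u∈S u~w → only-s u∈S (dominates⇒near u~w)

module UpperBound (d b : ℕ) {S : Subset (suc d * b)}
                  (minimal : IsMinimalDominating G[ d , b ] S) where
  open Coordinates d b

  private-neighbour : ∀ {s} → s ∈ S → ∃[ w ] Near s w × (∀ {u} → u ∈ S → Near u w → u ≡ s)
  private-neighbour s∈S =
    let (w , w-private) = minimal⇒private-neighbour G adjacent? minimal s∈S
    in  w , private-neighbour⇒near w-private

  all-outer⇒only-outer : (∀ {x} → row x ≡ zero → x ∈ S) → ∀ {x} → x ∈ S → row x ≡ zero
  all-outer⇒only-outer outer∈S x∈S =
    let (w , _ , only-x) = private-neighbour x∈S
        j = col w
        o≡x = only-x (outer∈S (row-outer j)) (inj₂ (col-outer j , inj₁ (row-outer j)))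
    in  trans (cong row (sym o≡x)) (row-outer j)

  two-outer⇒empty-row : ∀ {o o′} → o ∈ S → row o ≡ zero → o′ ∈ S → row o′ ≡ zero → o′ ≢ o →
    ∃[ i ] ∀ {u} → u ∈ S → row u ≢ suc i
  two-outer⇒empty-row {o} o∈S ro o′∈S ro′ o′≢o with private-neighbour o∈S
  ... | w , _ , only-o with zero-or-suc (row w)
  ...   | inj₁ rw = ⊥-elim (o′≢o (only-o o′∈S (inj₁ (trans ro′ (sym rw)))))
  ...   | inj₂ (i , rw) = i , λ u∈S ru →
    let u≡o = only-o u∈S (inj₁ (trans ru (sym rw)))
    in  0≢1+n (trans (sym ro) (trans (cong row (sym u≡o)) ru))

  Crowded : Vertex → Set
  Crowded s = ∃[ t ] t ∈ S × t ≢ s × row t ≡ row s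

  crowded? : ∀ s → Dec (Crowded s)
  crowded? s = any? (λ t → t ∈? S ×-dec ¬? (t ≟ s) ×-dec row t ≟ row s)

  Alone : Vertex → Set
  Alone s = ∀ {t} → t ∈ S → row t ≡ row s → t ≡ s

  ¬crowded⇒alone : ∀ {s} → ¬ Crowded s → Alone s
  ¬crowded⇒alone {s} ¬crowded {t} t∈S rt =
    decidable-stable (t ≟ s) (λ t≢s → ¬crowded (t , t∈S , t≢s , rt))

  crowded⇒¬alone : ∀ {s} → Crowded s → ¬ Alone s
  crowded⇒¬alone (t , t∈S , t≢s , rt) alone = t≢s (alone t∈S rt)

  module _ {s} (s∈S : s ∈ S) (inner : row s ≢ zero) (crowded : Crowded s) where

    crowded-private-neighbour :
      ∃[ w ] row w ≡ zero × col w ≡ col s × (∀ {u} → u ∈ S → Near u w → u ≡ s)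
    crowded-private-neighbour with private-neighbour s∈S
    ... | w , inj₁ rs≡rw , only-s =
      ⊥-elim (crowded⇒¬alone crowded (λ t∈S rt → only-s t∈S (inj₁ (trans rt rs≡rw))))
    ... | w , inj₂ (_ , inj₁ rs≡0) , _ = ⊥-elim (inner rs≡0)
    ... | w , inj₂ (cs≡cw , inj₂ rw≡0) , only-s = w , rw≡0 , sym cs≡cw , only-s

    crowded⇒no-outer : ∀ {u} → u ∈ S → row u ≢ zero
    crowded⇒no-outer u∈S ru≡0 =
      let (w , rw≡0 , _ , only-s) = crowded-private-neighbour
      in  inner (subst (λ v → row v ≡ zero) (only-s u∈S (inj₁ (trans ru≡0 (sym rw≡0)))) ru≡0)

    crowded⇒column-unique : ∀ {u} → u ∈ S → col u ≡ col s → u ≡ s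
    crowded⇒column-unique u∈S cu =
      let (w , rw≡0 , cw , only-s) = crowded-private-neighbour
      in  only-s u∈S (inj₂ (trans cu (sym cw) , inj₂ rw≡0))

  data Kind (x : Vertex) : Set where
    is-outer   : row x ≡ zero → Kind x
    is-crowded : row x ≢ zero → Crowded x → Kind x
    is-alone   : ∀ i → row x ≡ suc i → Alone x → Kind x

  kind : ∀ x → Kind x
  kind x with zero-or-suc (row x) | crowded? x
  ... | inj₁ rx       | _          = is-outer rx
  ... | inj₂ (i , rx) | yes c      = is-crowded (λ rx≡0 → 0≢1+n (trans (sym rx≡0) rx)) c
  ... | inj₂ (i , rx) | no ¬c      = is-alone i rx (¬crowded⇒alone ¬c)

  charge-of : ∀ {x} → Kind x → Fin d ⊎ Fin b
  charge-of {x} (is-outer _)     = inj₂ (col x)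
  charge-of {x} (is-crowded _ _) = inj₂ (col x)
  charge-of (is-alone i _ _)     = inj₁ i

  charge : Vertex → Fin d ⊎ Fin b
  charge x = charge-of (kind x)

  charge-injective : ∀ {x y} → x ∈ S → y ∈ S → charge x ≡ charge y → x ≡ y
  charge-injective {x} {y} x∈S y∈S = by-kind (kind x) (kind y)
    where
    by-kind : (k : Kind x) (k′ : Kind y) → charge-of k ≡ charge-of k′ → x ≡ y
    by-kind (is-outer rx) (is-outer ry) e =
      row-col-injective (trans rx (sym ry)) (inj₂-injective e)
    by-kind (is-outer _) (is-crowded ry cy) e =
      crowded⇒column-unique y∈S ry cy x∈S (inj₂-injective e)
    by-kind (is-crowded rx cx) (is-outer _) e =
      sym (crowded⇒column-unique x∈S rx cx y∈S (inj₂-injective (sym e)))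
    by-kind (is-crowded rx cx) (is-crowded _ _) e =
      sym (crowded⇒column-unique x∈S rx cx y∈S (inj₂-injective (sym e)))
    by-kind (is-alone i rx ax) (is-alone _ ry _) e =
      sym (ax y∈S (trans ry (trans (cong suc (sym (inj₁-injective e))) (sym rx))))
    by-kind (is-outer _)       (is-alone _ _ _)   ()
    by-kind (is-crowded _ _)   (is-alone _ _ _)   ()
    by-kind (is-alone _ _ _)   (is-outer _)       ()
    by-kind (is-alone _ _ _)   (is-crowded _ _)   ()

  Hit : Fin d ⊎ Fin b → Set
  Hit t = ∃[ x ] x ∈ S × charge x ≡ t

  hit? : ∀ t → Dec (Hit t)
  hit? t = any? (λ x → x ∈? S ×-dec ≡-dec _≟_ _≟_ (charge x) t)

  row-hit : ∀ {i} → Hit (inj₁ i) → ∃[ x ] x ∈ S × row x ≡ suc i × Alone x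
  row-hit {i} (x , x∈S , e) = x , x∈S , by-kind (kind x) e
    where
    by-kind : (k : Kind x) → charge-of k ≡ inj₁ i → row x ≡ suc i × Alone x
    by-kind (is-alone _ rx ax) refl = rx , ax
    by-kind (is-outer _)       ()
    by-kind (is-crowded _ _)   ()

  column-hit : ∀ {j} → Hit (inj₂ j) →
    ∃[ x ] x ∈ S × col x ≡ j × (row x ≡ zero ⊎ (row x ≢ zero × Crowded x))
  column-hit {j} (x , x∈S , e) = x , x∈S , by-kind (kind x) e
    where
    by-kind : (k : Kind x) → charge-of k ≡ inj₂ j →
      col x ≡ j × (row x ≡ zero ⊎ (row x ≢ zero × Crowded x))
    by-kind (is-outer rx)      refl = refl , inj₁ rx
    by-kind (is-crowded rx cx) refl = refl , inj₂ (rx , cx)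
    by-kind (is-alone _ _ _)   ()

  empty-row⇒missed : ∀ {i} → (∀ {u} → u ∈ S → row u ≢ suc i) → ¬ Hit (inj₁ i)
  empty-row⇒missed empty hit = let (x , x∈S , rx , _) = row-hit hit in empty x∈S rx

  crowded-row⇒missed : ∀ {s i} → s ∈ S → row s ≡ suc i → Crowded s → ¬ Hit (inj₁ i)
  crowded-row⇒missed s∈S rs cs hit =
    let (x , x∈S , rx , ax) = row-hit hit
        s≡x = ax s∈S (trans rs (sym rx))
    in  crowded⇒¬alone (subst Crowded s≡x cs) ax

  TwoMissed : Set
  TwoMissed = ∃₂ λ t t′ → t ≢ t′ × ¬ Hit t × ¬ Hit t′

  module WithOuter {o} (o∈S : o ∈ S) (ro : row o ≡ zero) where

    outer-column-hit : ∀ {j} → Hit (inj₂ j) → ∃[ y ] y ∈ S × row y ≡ zero × col y ≡ j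
    outer-column-hit hit with column-hit hit
    ... | y , y∈S , cy , inj₁ ry        = y , y∈S , ry , cy
    ... | y , y∈S , cy , inj₂ (ry , cs) = ⊥-elim (crowded⇒no-outer y∈S ry cs o∈S ro)

    absent-outer⇒missed : ∀ {x} → row x ≡ zero → x ∉ S → ¬ Hit (inj₂ (col x))
    absent-outer⇒missed rx x∉S hit =
      let (y , y∈S , ry , cy) = outer-column-hit hit
      in  x∉S (subst (_∈ S) (row-col-injective (trans ry (sym rx)) cy) y∈S)

    unique-outer⇒missed : (∀ {y} → y ∈ S → row y ≡ zero → y ≡ o) →
      ∀ {j} → j ≢ col o → ¬ Hit (inj₂ j)
    unique-outer⇒missed unique j≢co hit =
      let (y , y∈S , ry , cy) = outer-column-hit hit
      in  j≢co (trans (sym cy) (cong col (unique y∈S ry)))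

    two-missed : 2 ≤ d → 3 ≤ b → TwoMissed
    two-missed 2≤d 3≤b with any? (λ x → x ∈? S ×-dec row x ≟ zero ×-dec ¬? (x ≟ o))
    ... | no ¬second =
      let (j , j′ , j≢co , j′≢co , j≢j′) = two-others 3≤b (col o)
          unique : ∀ {y} → y ∈ S → row y ≡ zero → y ≡ o
          unique y∈S ry = decidable-stable (_ ≟ o) (λ y≢o → ¬second (_ , y∈S , ry , y≢o))
      in  inj₂ j , inj₂ j′ , j≢j′ ∘ inj₂-injective ,
          unique-outer⇒missed unique j≢co , unique-outer⇒missed unique j′≢co
    ... | yes (o′ , o′∈S , ro′ , o′≢o) with two-outer⇒empty-row o∈S ro o′∈S ro′ o′≢o
    ...   | i , row-i-empty with any? (λ x → row x ≟ zero ×-dec ¬? (x ∈? S))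
    ...     | yes (x , rx , x∉S) =
      inj₁ i , inj₂ (col x) , (λ ()) , empty-row⇒missed row-i-empty , absent-outer⇒missed rx x∉S
    ...     | no ¬absent =
      let (i′ , i′≢i) = another 2≤d i
          only-outer = all-outer⇒only-outer
            (λ {x} rx → decidable-stable (x ∈? S) (λ x∉S → ¬absent (x , rx , x∉S)))
          every-row-empty : ∀ {k u} → u ∈ S → row u ≢ suc k
          every-row-empty u∈S ru = 0≢1+n (trans (sym (only-outer u∈S)) ru)
      in  inj₁ i , inj₁ i′ , i′≢i ∘ sym ∘ inj₁-injective ,
          empty-row⇒missed every-row-empty , empty-row⇒missed every-row-empty

  module WithoutOuter (no-outer : ∀ {x} → x ∈ S → row x ≢ zero) where

    all-columns-hit⇒rows-missed : (∀ j → Hit (inj₂ j)) → ∀ i → ¬ Hit (inj₁ i)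
    all-columns-hit⇒rows-missed all-hit i hit with row-hit hit
    ... | x , x∈S , _ , ax with column-hit (all-hit (col x))
    ...   | y , y∈S , cy , inj₁ ry        = no-outer y∈S ry
    ...   | y , y∈S , cy , inj₂ (ry , cs) =
      crowded⇒¬alone (subst Crowded (sym (crowded⇒column-unique y∈S ry cs x∈S (sym cy))) cs) ax

    no-crowded⇒columns-missed : (∀ {x} → x ∈ S → ¬ Crowded x) → ∀ j → ¬ Hit (inj₂ j)
    no-crowded⇒columns-missed no-crowded j hit with column-hit hit
    ... | y , y∈S , _ , inj₁ ry       = no-outer y∈S ry
    ... | y , y∈S , _ , inj₂ (_ , cs) = no-crowded y∈S cs

    two-missed : 2 ≤ d → 2 ≤ b → TwoMissed
    two-missed 2≤d 2≤b with any? (λ x → x ∈? S ×-dec crowded? x)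
    ... | no ¬crowded =
      let (j , j′ , j≢j′) = distinct-pair 2≤b
          columns-missed = no-crowded⇒columns-missed (λ x∈S cs → ¬crowded (_ , x∈S , cs))
      in  inj₂ j , inj₂ j′ , j≢j′ ∘ inj₂-injective , columns-missed j , columns-missed j′
    ... | yes (s , s∈S , cs) with zero-or-suc (row s)
    ...   | inj₁ rs = ⊥-elim (no-outer s∈S rs)
    ...   | inj₂ (i , rs) with any? (λ j → ¬? (hit? (inj₂ j)))
    ...     | yes (j , ¬hit) = inj₁ i , inj₂ j , (λ ()) , crowded-row⇒missed s∈S rs cs , ¬hit
    ...     | no ¬missed =
      let (i′ , i′≢i) = another 2≤d i
          rows-missed = all-columns-hit⇒rows-missed
            (λ j → decidable-stable (hit? (inj₂ j)) (λ ¬hit → ¬missed (j , ¬hit)))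
      in  inj₁ i , inj₁ i′ , i′≢i ∘ sym ∘ inj₁-injective , rows-missed i , rows-missed i′

  two-missed : 2 ≤ d → 3 ≤ b → TwoMissed
  two-missed 2≤d 3≤b with any? (λ x → x ∈? S ×-dec row x ≟ zero)
  ... | yes (o , o∈S , ro) = WithOuter.two-missed o∈S ro 2≤d 3≤b
  ... | no ¬outer =
    WithoutOuter.two-missed (λ x∈S rx → ¬outer (_ , x∈S , rx)) 2≤d (≤-trans (n≤1+n 2) 3≤b)

  ∣S∣≤d+b∸2 : 2 ≤ d → 3 ≤ b → ∣ S ∣ ≤ d + b ∸ 2
  ∣S∣≤d+b∸2 2≤d 3≤b =
    let (t , t′ , t≢t′ , ¬hit , ¬hit′) = two-missed 2≤d 3≤b
    in  injectiveOn-avoiding-two⇒∣p∣≤n∸2 {f = join d b ∘ charge}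
          (λ x∈S y∈S → charge-injective x∈S y∈S ∘ join-injective d b)
          (t≢t′ ∘ join-injective d b)
          (λ x∈S e → ¬hit (_ , x∈S , join-injective d b e))
          (λ x∈S e → ¬hit′ (_ , x∈S , join-injective d b e))

module Construction (d′ b′ : ℕ) where
  open Coordinates (suc (suc d′)) (suc (suc b′))

  member : Position → Bool
  member (zero          , _)     = false
  member (suc zero      , zero)  = false
  member (suc zero      , suc _) = true
  member (suc (suc _)   , zero)  = true
  member (suc (suc _)   , suc _) = false

  S₀ : Subset (suc (suc (suc d′)) * suc (suc b′))
  S₀ = tabulate (member ∘ position)

  lookup-S₀ : ∀ p → lookup S₀ (uncurry vtx p) ≡ member p
  lookup-S₀ (i , j) =
    trans (lookup∘tabulate (member ∘ position) (vtx i j)) (cong member (position-vtx i j))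

  vtx∈S₀ : ∀ p → member p ≡ true → uncurry vtx p ∈ S₀
  vtx∈S₀ p m = lookup⇒[]= (uncurry vtx p) S₀ (trans (lookup-S₀ p) m)

  vtx∈S₀⁻ : ∀ p → uncurry vtx p ∈ S₀ → member p ≡ true
  vtx∈S₀⁻ p v∈S₀ = trans (sym (lookup-S₀ p)) ([]=⇒lookup v∈S₀)

  S₀-dominator : ∀ p → member p ≢ true → ∃[ q ] member q ≡ true × q ∼ p
  S₀-dominator (zero          , zero)  _ = (suc (suc zero) , zero) , refl , inj₂ (refl , inj₂ refl)
  S₀-dominator (zero          , suc j) _ = (suc zero , suc j) , refl , inj₂ (refl , inj₂ refl)
  S₀-dominator (suc zero      , zero)  _ = (suc zero , suc zero) , refl , inj₁ refl
  S₀-dominator (suc zero      , suc j) p∉S₀ = ⊥-elim (p∉S₀ refl)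
  S₀-dominator (suc (suc i)   , zero)  p∉S₀ = ⊥-elim (p∉S₀ refl)
  S₀-dominator (suc (suc i)   , suc j) _ = (suc (suc i) , zero) , refl , inj₁ refl

  S₀-dominating : IsDominating G S₀
  S₀-dominating v v∉S₀ with coords v
  ... | at i j =
    let (q , q∈S₀ , q∼p) = S₀-dominator (i , j) (v∉S₀ ∘ vtx∈S₀ (i , j))
        u∈S₀ = vtx∈S₀ q q∈S₀
        u∼v = near-vtx q (i , j) q∼p
    in  uncurry vtx q , u∈S₀ , dominates⇒adjacent G u∈S₀ v∉S₀ (near⇒dominates u∼v)

  member-near-outer : ∀ {j} q → member q ≡ true → q ∼ (zero , suc j) → q ≡ (suc zero , suc j)
  member-near-outer (zero        , _)     ()
  member-near-outer (suc zero    , zero)  ()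
  member-near-outer (suc zero    , suc j) _ (inj₁ ())
  member-near-outer (suc zero    , suc j) _ (inj₂ (refl , _)) = refl
  member-near-outer (suc (suc i) , zero)  _ (inj₁ ())
  member-near-outer (suc (suc i) , zero)  _ (inj₂ (() , _))
  member-near-outer (suc (suc i) , suc j) ()

  member-near-second-column : ∀ {i} q → member q ≡ true → q ∼ (suc (suc i) , suc zero) →
    q ≡ (suc (suc i) , zero)
  member-near-second-column (zero        , _)     ()
  member-near-second-column (suc zero    , zero)  ()
  member-near-second-column (suc zero    , suc j) _ (inj₁ ())
  member-near-second-column (suc zero    , suc j) _ (inj₂ (_ , inj₁ ()))
  member-near-second-column (suc zero    , suc j) _ (inj₂ (_ , inj₂ ()))
  member-near-second-column (suc (suc i) , zero)  _ (inj₁ refl) = refl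
  member-near-second-column (suc (suc i) , zero)  _ (inj₂ (() , _))
  member-near-second-column (suc (suc i) , suc j) ()

  private-neighbour-at : ∀ p w → p ∼ w → (∀ q → member q ≡ true → q ∼ w → q ≡ p) →
    IsPrivateNeighbour G S₀ (uncurry vtx p) (uncurry vtx w)
  private-neighbour-at p w p∼w only-p = near⇒private-neighbour (near-vtx p w p∼w) only
    where
    only : ∀ {u} → u ∈ S₀ → Near u (uncurry vtx w) → u ≡ uncurry vtx p
    only {u} u∈S₀ u∼w with coords u
    ... | at i j =
      cong (uncurry vtx) (only-p (i , j) (vtx∈S₀⁻ (i , j) u∈S₀) (vtx-near (i , j) w u∼w))

  S₀-private-neighbour : ∀ p → member p ≡ true → ∃[ w ] IsPrivateNeighbour G S₀ (uncurry vtx p) w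
  S₀-private-neighbour p@(suc zero , suc j) _ =
    outer (suc j) , private-neighbour-at p (zero , suc j) (inj₂ (refl , inj₂ refl)) member-near-outer
  S₀-private-neighbour p@(suc (suc i) , zero) _ =
    vtx (suc (suc i)) (suc zero) ,
    private-neighbour-at p (suc (suc i) , suc zero) (inj₁ refl) member-near-second-column
  S₀-private-neighbour (zero        , _)     ()
  S₀-private-neighbour (suc zero    , zero)  ()
  S₀-private-neighbour (suc (suc i) , suc j) ()

  S₀-minimal : IsMinimalDominating G S₀
  S₀-minimal = private-neighbours⇒minimal G S₀-dominating has-private
    where
    has-private : ∀ {s} → s ∈ S₀ → ∃[ w ] IsPrivateNeighbour G S₀ s w
    has-private {s} s∈S₀ with coords s
    ... | at i j = S₀-private-neighbour (i , j) (vtx∈S₀⁻ (i , j) s∈S₀)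

  chosen-position : Fin (suc d′) ⊎ Fin (suc b′) → Position
  chosen-position (inj₁ i) = suc (suc i) , zero
  chosen-position (inj₂ j) = suc zero , suc j

  chosen-position-injective : ∀ {t t′} → chosen-position t ≡ chosen-position t′ → t ≡ t′
  chosen-position-injective {inj₁ i} {inj₁ .i} refl = refl
  chosen-position-injective {inj₂ j} {inj₂ .j} refl = refl
  chosen-position-injective {inj₁ i} {inj₂ j} ()
  chosen-position-injective {inj₂ j} {inj₁ i} ()

  chosen : Fin (suc d′) ⊎ Fin (suc b′) → Vertex
  chosen = uncurry vtx ∘ chosen-position

  chosen∈S₀ : ∀ t → chosen t ∈ S₀
  chosen∈S₀ (inj₁ i) = vtx∈S₀ (suc (suc i) , zero) refl
  chosen∈S₀ (inj₂ j) = vtx∈S₀ (suc zero , suc j) refl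

  chosen-injective : ∀ {t t′} → chosen t ≡ chosen t′ → t ≡ t′
  chosen-injective {t} {t′} =
    chosen-position-injective ∘ vtx-injective (chosen-position t) (chosen-position t′)

  d+b∸2≤∣S₀∣ : d′ + suc (suc b′) ≤ ∣ S₀ ∣
  d+b∸2≤∣S₀∣ =
    subst (_≤ ∣ S₀ ∣) (trans (∣⊤∣≡n (suc d′ + suc b′)) (sym (+-suc d′ (suc b′))))
    (injectiveOn⇒∣p∣≤∣q∣ {p = ⊤} S₀ {f = chosen ∘ splitAt (suc d′)}
      (λ _ _ → splitAt-injective (suc d′) (suc b′) ∘ chosen-injective)
      (λ {t} _ → chosen∈S₀ (splitAt (suc d′) t)))

construction : ∀ {d b} → 2 ≤ d → 2 ≤ b →
  ∃[ S ] IsMinimalDominating G[ d , b ] S × d + b ∸ 2 ≤ ∣ S ∣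
construction {suc (suc d′)} {suc (suc b′)} (s≤s (s≤s _)) (s≤s (s≤s _)) =
  S₀ , S₀-minimal , d+b∸2≤∣S₀∣
  where open Construction d′ b′

lemma1 : (d b : ℕ) → 3 ≤ b → 2 ≤ d →
    UpperDominationNumber G[ d , b ] (d + b ∸ 2)
lemma1 d b 3≤b 2≤d =
  let (S₀ , S₀-minimal , large) = construction 2≤d (≤-trans (n≤1+n 2) 3≤b)
  in  (S₀ , S₀-minimal , ≤-antisym (upper S₀-minimal) large) , λ S → upper
  where
  upper : ∀ {S} → IsMinimalDominating G[ d , b ] S → ∣ S ∣ ≤ d + b ∸ 2
  upper minimal = UpperBound.∣S∣≤d+b∸2 d b minimal 2≤d 3≤b
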